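{- Let $G$ be a finite simple connected graph whose block tree has more than one vertex, let $B$ be an end block of $G$, and let $u$ be the unique cut vertex of $G$ contained in $B$. Assume that $\{u\}$ is a dominating set for $B$ (every vertex of $B$ other than $u$ is adjacent to $u$). Let $H$ be the graph obtained by contracting the subgraph $B$ into the vertex $u$ (i.e. $H=G-(V(B)\setminus\{u\})$). Then $c_{\infty}(H)\ge c_{\infty}(G)$.
   Context: Game with an unbounded-speed robber: on a graph $G$, a set of cops first choose vertices (several cops may share a vertex), then the robber, knowing their positions, chooses a vertex. Then the cops and the robber move alternately, cops first. In the cops' turn, each cop moves to an adjacent vertex or stays. In the robber's turn, she may move along any path of $G$ starting at her current vertex that contains no vertex currently occupied by a cop, or stay. The cops win if at some point a cop occupies the robber's vertex. $c_{\infty}(G)$ is the minimum number of cops that guarantees a cop win. A block of a connected graph is either a maximal 2-connected subgraph or an edge not contained in any 2-connected subgraph. The block tree $B(G)$ has as vertices the blocks and the cut vertices of $G$, a block adjacent to a cut vertex iff it contains it. End blocks are the blocks corresponding to leaves of $B(G)$. -}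

module Defs where

open import Data.Nat using (ℕ; _≤_)
open import Data.Fin using (Fin)
open import Data.Bool using (Bool; true; false; T)
open import Data.Fin.Subset using (Subset; _∈_; _∉_; _⊆_; ⊤; ∁; _∪_; ⁅_⁆)
open import Data.Product using (Σ; ∃; _×_; _,_)
open import Data.Sum using (_⊎_)
open import Relation.Nullary using (¬_)
open import Relation.Binary.PropositionalEquality using (_≡_; _≢_)

record Graph (n : ℕ) : Set where
  field
    adj   : Fin n → Fin n → Bool
    sym   : ∀ x y → adj x y ≡ adj y x
    irrefl : ∀ x → adj x x ≡ false

open Graph public

E : ∀ {n} → Graph n → Fin n → Fin n → Set
E G x y = T (adj G x y)

data Walk {n} (G : Graph n) (P : Fin n → Set) (x : Fin n) : Fin n → Set where
  here : P x → Walk G P x x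
  step : ∀ {y z} → Walk G P x y → E G y z → P z → Walk G P x z

Connected : ∀ {n} → Graph n → Set
Connected {n} G = ∀ (x y : Fin n) → Walk G (λ _ → Data.Unit.⊤) x y
  where import Data.Unit

IsCutVertex : ∀ {n} → Graph n → Fin n → Set
IsCutVertex {n} G v =
  Σ (Fin n) λ x → Σ (Fin n) λ y → x ≢ v × y ≢ v × ¬ Walk G (λ w → w ≢ v) x y

-- The induced subgraph G[S] is connected, has at least two vertices,
-- and has no cut vertex (G[S] - v connected for every v ∈ S):
-- i.e. G[S] is 2-connected or a single edge.
Nonseparable : ∀ {n} → Graph n → Subset n → Set
Nonseparable {n} G S =
  (Σ (Fin n) λ x → Σ (Fin n) λ y → x ∈ S × y ∈ S × x ≢ y)
  × (∀ x y → x ∈ S → y ∈ S → Walk G (λ w → w ∈ S) x y)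
  × (∀ v x y → v ∈ S → x ∈ S → y ∈ S → x ≢ v → y ≢ v →
       Walk G (λ w → w ∈ S × w ≢ v) x y)

IsBlock : ∀ {n} → Graph n → Subset n → Set
IsBlock {n} G S = Nonseparable G S × (∀ (T : Subset n) → S ⊆ T → Nonseparable G T → T ⊆ S)

-- The block tree B(G) has more than one vertex: its vertex set (blocks ⊎ cut vertices)
-- contains two distinct elements.
BlockTreeNontrivial : ∀ {n} → Graph n → Set
BlockTreeNontrivial {n} G =
  (Σ (Subset n) λ B₁ → Σ (Subset n) λ B₂ → IsBlock G B₁ × IsBlock G B₂ × B₁ ≢ B₂)
  ⊎ ((Σ (Fin n) λ v → Σ (Fin n) λ w → IsCutVertex G v × IsCutVertex G w × v ≢ w)
  ⊎ ((Σ (Subset n) λ B → IsBlock G B) × (Σ (Fin n) λ v → IsCutVertex G v)))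

-- End block: a block that is a leaf of B(G), i.e. contains exactly one cut vertex.
IsEndBlock : ∀ {n} → Graph n → Subset n → Set
IsEndBlock {n} G B = IsBlock G B ×
  (Σ (Fin n) λ w → w ∈ B × IsCutVertex G w × (∀ w' → w' ∈ B → IsCutVertex G w' → w' ≡ w))

Occupied : ∀ {n k} → (Fin k → Fin n) → Fin n → Set
Occupied {k = k} C v = Σ (Fin k) λ i → C i ≡ v

CopStep : ∀ {n k} → Graph n → Subset n → (Fin k → Fin n) → (Fin k → Fin n) → Set
CopStep G W C C' = ∀ i → C' i ∈ W × (C' i ≡ C i ⊎ E G (C i) (C' i))

RobberMove : ∀ {n k} → Graph n → Subset n → (Fin k → Fin n) → Fin n → Fin n → Set
RobberMove G W C r r' = Walk G (λ w → w ∈ W × ¬ Occupied C w) r r'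

-- CopWin G W C r : cops at C, robber at r, cops to move; cops can force a capture.
-- (Inductive = the cops can force capture in finitely many rounds.)
data CopWin {n k} (G : Graph n) (W : Subset n) : (Fin k → Fin n) → Fin n → Set where
  move : ∀ {C r} (C' : Fin k → Fin n) → CopStep G W C C' →
         (Occupied C' r ⊎ (∀ r' → RobberMove G W C' r r' → CopWin G W C' r')) →
         CopWin G W C r

CopsWin : ∀ {n} → Graph n → Subset n → ℕ → Set
CopsWin {n} G W k =
  Σ (Fin k → Fin n) λ C → (∀ i → C i ∈ W) ×
    (∀ r → r ∈ W → Occupied C r ⊎ CopWin G W C r)

IsCopNumberInf : ∀ {n} → Graph n → Subset n → ℕ → Set
IsCopNumberInf G W c = CopsWin G W c × (∀ k → CopsWin G W k → c ≤ k)

ContractSet : ∀ {n} → Subset n → Fin n → Subset n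
ContractSet B u = ∁ B ∪ ⁅ u ⁆

-- The cops play their winning strategy for H against the robber's shadow: the robber
-- herself while she is outside B ∖ {u}, and u while she hides in B ∖ {u}.  No vertex of
-- a block other than a cut vertex has a neighbour outside the block (otherwise a path
-- leaving and re-entering the block would be an ear enlarging it), so B ∖ {u} is
-- attached to the rest of G only through u.  Hence every robber move in G projects to
-- a legal shadow move in H, and once a cop stands on the shadow u the robber is trapped
-- in B ∖ {u}, where the cop on u, which dominates B, catches her on the next move.

module Submission where

open import Defs hiding (sym)
open import Data.Nat using (ℕ; _≤_)
open import Data.Fin using (Fin; _≟_)
open import Data.Fin.Subset using (Subset; _∈_; _∉_; ⊤; ⋃; ⁅_⁆; _∪_)
open import Data.Fin.Subset.Properties
  using (_∈?_; ∈⊤; ∉⊥; x∈⁅x⁆; x∈⁅y⁆⇒x≡y; x∈p∪q⁺; x∈p∪q⁻; x∉p⇒x∈∁p; p⊆p∪q)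
open import Data.Fin.Properties using (any?)
open import Data.Bool using (T)
open import Data.List using (List; []; _∷_; map)
open import Data.List.Relation.Unary.Any using (here; there)
import Data.List.Relation.Unary.Any as Any
open import Data.List.Membership.Propositional using () renaming (_∈_ to _∈ₗ_; _∉_ to _∉ₗ_)
open import Data.Vec.Functional using (updateAt)
open import Data.Vec.Functional.Properties using (updateAt-updates; updateAt-minimal)
open import Data.Product using (∃; ∃₂; _×_; _,_; proj₁; proj₂; map₁)
open import Data.Sum using (_⊎_; inj₁; inj₂; [_,_])
import Data.Sum as Sum
open import Data.Empty using (⊥-elim)
open import Function using (_∘_; id; const)
open import Relation.Nullary using (¬_; Dec; yes; no)
open import Relation.Nullary.Decidable using (decidable-stable; _×-dec_; ¬?)
open import Relation.Binary.PropositionalEquality using (_≡_; _≢_; refl; sym; subst; subst₂)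

fromList : ∀ {n} → List (Fin n) → Subset n
fromList vs = ⋃ (map ⁅_⁆ vs)

∈-fromList⁺ : ∀ {n} {w : Fin n} {vs} → w ∈ₗ vs → w ∈ fromList vs
∈-fromList⁺ (here refl) = x∈p∪q⁺ (inj₁ (x∈⁅x⁆ _))
∈-fromList⁺ (there w∈) = x∈p∪q⁺ (inj₂ (∈-fromList⁺ w∈))

∈-fromList⁻ : ∀ {n} {w : Fin n} vs → w ∈ fromList vs → w ∈ₗ vs
∈-fromList⁻ [] w∈ = ⊥-elim (∉⊥ w∈)
∈-fromList⁻ (v ∷ vs) w∈ with x∈p∪q⁻ ⁅ v ⁆ (fromList vs) w∈
... | inj₁ w∈⁅v⁆ = here (x∈⁅y⁆⇒x≡y v w∈⁅v⁆)
... | inj₂ w∈vs = there (∈-fromList⁻ vs w∈vs)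

module _ {n : ℕ} (G : Graph n) where

  E-sym : ∀ {x y} → E G x y → E G y x
  E-sym {x} {y} = subst T (Graph.sym G x y)

  E⇒≢ : ∀ {x y} → E G x y → x ≢ y
  E⇒≢ {x} loop refl = subst T (Graph.irrefl G x) loop

  Walk-target : ∀ {P x y} → Walk G P x y → P y
  Walk-target (here px) = px
  Walk-target (step _ _ pz) = pz

  Walk-map : ∀ {P Q : Fin n → Set} {x y} → (∀ {w} → P w → Q w) → Walk G P x y → Walk G Q x y
  Walk-map f (here px) = here (f px)
  Walk-map f (step walk e pz) = step (Walk-map f walk) e (f pz)

  infixr 5 _++ʷ_

  _++ʷ_ : ∀ {P x y z} → Walk G P x y → Walk G P y z → Walk G P x z
  walk ++ʷ here _ = walk
  walk ++ʷ step walk′ e pz = step (walk ++ʷ walk′) e pz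

  Walk-reverse : ∀ {P x y} → Walk G P x y → Walk G P y x
  Walk-reverse (here px) = here px
  Walk-reverse (step walk e pz) =
    step (here pz) (E-sym e) (Walk-target walk) ++ʷ Walk-reverse walk

  data Path (P : Fin n → Set) (x : Fin n) : Fin n → List (Fin n) → Set where
    start  : P x → Path P x x (x ∷ [])
    extend : ∀ {y z vs} → Path P x y vs → E G y z → P z → z ∉ₗ vs → Path P x z (z ∷ vs)

  Path-target∈ : ∀ {P x y vs} → Path P x y vs → y ∈ₗ vs
  Path-target∈ (start _) = here refl
  Path-target∈ (extend _ _ _ _) = here refl

  Path-source∈ : ∀ {P x y vs} → Path P x y vs → x ∈ₗ vs
  Path-source∈ (start _) = here refl
  Path-source∈ (extend path _ _ _) = there (Path-source∈ path)

  Path-all : ∀ {P x y vs z} → Path P x y vs → z ∈ₗ vs → P z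
  Path-all (start px) (here refl) = px
  Path-all (extend _ _ pz _) (here refl) = pz
  Path-all (extend path _ _ _) (there z∈) = Path-all path z∈

  Path-prefix : ∀ {P x y vs z} → Path P x y vs → z ∈ₗ vs → ∃ λ ws → Path P x z ws
  Path-prefix (start px) (here refl) = _ , start px
  Path-prefix path@(extend _ _ _ _) (here refl) = _ , path
  Path-prefix (extend path _ _ _) (there z∈) = Path-prefix path z∈

  walk⇒path : ∀ {P x y} → Walk G P x y → ∃ λ vs → Path P x y vs
  walk⇒path (here px) = _ , start px
  walk⇒path (step {z = z} walk e pz) with walk⇒path walk
  ... | vs , path with Any.any? (z ≟_) vs
  ...   | yes z∈ = Path-prefix path z∈
  ...   | no z∉ = _ , extend path e pz z∉

  Path-to-source : ∀ {P x y vs z} → Path P x y vs → z ∈ₗ vs → Walk G (_∈ₗ vs) z x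
  Path-to-source (start _) (here refl) = here (here refl)
  Path-to-source (extend path e _ _) (here refl) =
    step (here (here refl)) (E-sym e) (there (Path-target∈ path))
      ++ʷ Walk-map there (Path-to-source path (Path-target∈ path))
  Path-to-source (extend path _ _ _) (there z∈) = Walk-map there (Path-to-source path z∈)

  Path-to-target : ∀ {P x y vs z} → Path P x y vs → z ∈ₗ vs → Walk G (_∈ₗ vs) z y
  Path-to-target (start _) (here refl) = here (here refl)
  Path-to-target (extend _ _ _ _) (here refl) = here (here refl)
  Path-to-target (extend path e _ _) (there z∈) =
    step (Walk-map there (Path-to-target path z∈)) e (here refl)

  -- Needs simplicity: on a walk, v could occur both before and after z.
  Path-to-end-avoiding : ∀ {P x y vs z v} → Path P x y vs → z ∈ₗ vs → v ∈ₗ vs → z ≢ v →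
    Walk G (λ w → w ∈ₗ vs × w ≢ v) z x ⊎ Walk G (λ w → w ∈ₗ vs × w ≢ v) z y
  Path-to-end-avoiding (start _) (here refl) (here refl) z≢v = ⊥-elim (z≢v refl)
  Path-to-end-avoiding (extend _ _ _ _) (here refl) (here refl) z≢v = ⊥-elim (z≢v refl)
  Path-to-end-avoiding (extend _ _ _ _) (here refl) (there _) z≢v = inj₂ (here (here refl , z≢v))
  Path-to-end-avoiding (extend path _ _ fresh) (there z∈) (here refl) _ =
    inj₁ (Walk-map (λ w∈ → there w∈ , λ { refl → fresh w∈ }) (Path-to-source path z∈))
  Path-to-end-avoiding (extend path e _ fresh) (there z∈) (there v∈) z≢v
    with Path-to-end-avoiding path z∈ v∈ z≢v
  ... | inj₁ walk = inj₁ (Walk-map (map₁ there) walk)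
  ... | inj₂ walk = inj₂ (step (Walk-map (map₁ there) walk) e (here refl , λ { refl → fresh v∈ }))

  Entry : (Fin n → Set) → Subset n → Fin n → Set
  Entry P S x = ∃₂ λ e c → Walk G (_∉ S) x e × E G e c × c ∈ S × P c

  outside-or-entry : ∀ {P x y} (S : Subset n) → x ∉ S → Walk G P x y →
    Walk G (_∉ S) x y ⊎ Entry P S x
  outside-or-entry S x∉S (here _) = inj₁ (here x∉S)
  outside-or-entry S x∉S (step {z = z} walk e pz) with outside-or-entry S x∉S walk
  ... | inj₂ entry = inj₂ entry
  ... | inj₁ outside with z ∈? S
  ...   | yes z∈S = inj₂ (_ , z , outside , e , z∈S , pz)
  ...   | no z∉S = inj₁ (step outside e z∉S)

  first-entry : ∀ {P x y} (S : Subset n) → x ∉ S → y ∈ S → Walk G P x y → Entry P S x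
  first-entry S x∉S y∈S walk =
    [ (λ outside → ⊥-elim (Walk-target outside y∈S)) , id ]
      (outside-or-entry S x∉S walk)

  hubs⇒nonseparable : ∀ {S : Subset n} →
    (∃₂ λ x y → x ∈ S × y ∈ S × x ≢ y) →
    (∃ λ h → ∀ {z} → z ∈ S → Walk G (_∈ S) z h) →
    (∀ {v} → v ∈ S → ∃ λ h → ∀ {z} → z ∈ S → z ≢ v → Walk G (λ w → w ∈ S × w ≢ v) z h) →
    Nonseparable G S
  hubs⇒nonseparable two (h , to-h) hub-avoiding =
    two
    , (λ _ _ x∈ y∈ → to-h x∈ ++ʷ Walk-reverse (to-h y∈))
    , λ _ _ _ v∈ x∈ y∈ x≢v y≢v →
        let (h′ , to-h′) = hub-avoiding v∈ in to-h′ x∈ x≢v ++ʷ Walk-reverse (to-h′ y∈ y≢v)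

  other-vertex : ∀ {S} → Nonseparable G S → ∀ b → ∃ λ c → c ∈ S × c ≢ b
  other-vertex ((x , y , x∈ , y∈ , x≢y) , _) b with x ≟ b
  ... | yes refl = y , y∈ , x≢y ∘ sym
  ... | no x≢b = x , x∈ , x≢b

  module _ {S : Subset n} (S-nonsep : Nonseparable G S) {a c x e vs}
           (a∈S : a ∈ S) (c∈S : c ∈ S) (c≢a : c ≢ a)
           (ax : E G a x) (ear : Path (_∉ S) x e vs) (ec : E G e c) where

    private
      InEar : Fin n → Set
      InEar w = w ∈ S ⊎ w ∈ₗ vs

      Avoiding : Fin n → Fin n → Set
      Avoiding v w = InEar w × w ≢ v

      S-connected : ∀ y z → y ∈ S → z ∈ S → Walk G (_∈ S) y z
      S-connected = proj₁ (proj₂ S-nonsep)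

      S-connected-without : ∀ v y z → v ∈ S → y ∈ S → z ∈ S → y ≢ v → z ≢ v →
        Walk G (λ w → w ∈ S × w ≢ v) y z
      S-connected-without = proj₂ (proj₂ S-nonsep)

      S≢ear : ∀ {w v} → w ∈ S → v ∈ₗ vs → w ≢ v
      S≢ear w∈S v∈ refl = Path-all ear v∈ w∈S

      S-walk : ∀ {v y z} → Walk G (λ w → w ∈ S × w ≢ v) y z → Walk G (Avoiding v) y z
      S-walk = Walk-map (map₁ inj₁)

      ear-walk : ∀ {v y z} → v ∈ S → Walk G (_∈ₗ vs) y z → Walk G (Avoiding v) y z
      ear-walk v∈S = Walk-map λ w∈ → inj₂ w∈ , S≢ear v∈S w∈ ∘ sym

      to-a : ∀ {z} → InEar z → Walk G InEar z a
      to-a (inj₁ z∈S) = Walk-map inj₁ (S-connected _ _ z∈S a∈S)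
      to-a (inj₂ z∈) = step (Walk-map inj₂ (Path-to-source ear z∈)) (E-sym ax) (inj₁ a∈S)

      hub-avoiding : ∀ {v} → InEar v → ∃ λ h → ∀ {z} → InEar z → z ≢ v → Walk G (Avoiding v) z h
      hub-avoiding {v} (inj₁ v∈S) with v ≟ a
      ... | yes refl = c , λ
        { (inj₁ z∈S) z≢v → S-walk (S-connected-without v _ c v∈S z∈S c∈S z≢v c≢a)
        ; (inj₂ z∈) _ → step (ear-walk v∈S (Path-to-target ear z∈)) ec (inj₁ c∈S , c≢a) }
      ... | no v≢a = a , λ
        { (inj₁ z∈S) z≢v → S-walk (S-connected-without v _ a v∈S z∈S a∈S z≢v (v≢a ∘ sym))
        ; (inj₂ z∈) _ →
            step (ear-walk v∈S (Path-to-source ear z∈)) (E-sym ax) (inj₁ a∈S , v≢a ∘ sym) }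
      hub-avoiding {v} (inj₂ v∈) = a , λ
        { (inj₁ z∈S) _ → S-avoiding (S-connected _ _ z∈S a∈S)
        ; (inj₂ z∈) z≢v → [ via-source , via-target ] (Path-to-end-avoiding ear z∈ v∈ z≢v) }
        where
        S-avoiding : ∀ {y z} → Walk G (_∈ S) y z → Walk G (Avoiding v) y z
        S-avoiding = Walk-map λ w∈S → inj₁ w∈S , S≢ear w∈S v∈

        via-source : ∀ {z} → Walk G (λ w → w ∈ₗ vs × w ≢ v) z x → Walk G (Avoiding v) z a
        via-source walk = step (Walk-map (map₁ inj₂) walk) (E-sym ax) (inj₁ a∈S , S≢ear a∈S v∈)

        via-target : ∀ {z} → Walk G (λ w → w ∈ₗ vs × w ≢ v) z e → Walk G (Avoiding v) z a
        via-target walk = step (Walk-map (map₁ inj₂) walk) ec (inj₁ c∈S , S≢ear c∈S v∈)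
                          ++ʷ S-avoiding (S-connected _ _ c∈S a∈S)

      InEar⇒∈ : ∀ {w} → InEar w → w ∈ S ∪ fromList vs
      InEar⇒∈ = x∈p∪q⁺ ∘ Sum.map₂ ∈-fromList⁺

      ∈⇒InEar : ∀ {w} → w ∈ S ∪ fromList vs → InEar w
      ∈⇒InEar = Sum.map₂ (∈-fromList⁻ vs) ∘ x∈p∪q⁻ S (fromList vs)

    ear-nonseparable : Nonseparable G (S ∪ fromList vs)
    ear-nonseparable = hubs⇒nonseparable two
      (a , Walk-map InEar⇒∈ ∘ to-a ∘ ∈⇒InEar)
      λ v∈ → let (h , to-h) = hub-avoiding (∈⇒InEar v∈) in
        h , λ z∈ z≢v → Walk-map (map₁ InEar⇒∈) (to-h (∈⇒InEar z∈) z≢v)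
      where
      two : ∃₂ λ x y → x ∈ S ∪ fromList vs × y ∈ S ∪ fromList vs × x ≢ y
      two = let (x , y , x∈ , y∈ , x≢y) = proj₁ S-nonsep in
        x , y , InEar⇒∈ (inj₁ x∈) , InEar⇒∈ (inj₁ y∈) , x≢y

  block-absorbs-ear : ∀ {B b x c} → IsBlock G B → b ∈ B → E G b x → c ∈ B →
    Walk G (_≢ b) x c → x ∈ B
  block-absorbs-ear {B} {x = x} (B-nonsep , B-maximal) b∈B bx c∈B walk with x ∈? B
  ... | yes x∈B = x∈B
  ... | no x∉B with first-entry B x∉B c∈B walk
  ...   | _ , _ , outside , ec′ , c′∈B , c′≢b with walk⇒path outside
  ...     | vs , ear =
    B-maximal (B ∪ fromList vs) (p⊆p∪q (fromList vs))
      (ear-nonseparable B-nonsep b∈B c′∈B c′≢b bx ear ec′)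
      (x∈p∪q⁺ (inj₂ (∈-fromList⁺ (Path-source∈ ear))))

  noncut⇒neighbours-in-block : ∀ {B b x} → IsBlock G B → b ∈ B → ¬ IsCutVertex G b →
    E G b x → x ∈ B
  noncut⇒neighbours-in-block {B} {b} {x} blk b∈B noncut bx =
    let (c , c∈B , c≢b) = other-vertex (proj₁ blk) b in
    decidable-stable (x ∈? B) λ x∉B →
      noncut (x , c , E⇒≢ (E-sym bx) , c≢b , x∉B ∘ block-absorbs-ear blk b∈B bx c∈B)

module _ {n : ℕ} (G : Graph n) (B : Subset n) (u : Fin n)
         (closed : ∀ {b x} → b ∈ B → b ≢ u → E G b x → x ∈ B)
         (dominating : ∀ v → v ∈ B → v ≢ u → E G u v) where

  private
    H : Subset n
    H = ContractSet B u

  Deep : Fin n → Set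
  Deep w = w ∈ B × w ≢ u

  Deep? : ∀ w → Dec (Deep w)
  Deep? w = w ∈? B ×-dec ¬? (w ≟ u)

  ∈B∧¬Deep⇒≡u : ∀ {w} → w ∈ B → ¬ Deep w → w ≡ u
  ∈B∧¬Deep⇒≡u {w} w∈B ¬deep = decidable-stable (w ≟ u) λ w≢u → ¬deep (w∈B , w≢u)

  ¬Deep⇒∈H : ∀ {w} → ¬ Deep w → w ∈ H
  ¬Deep⇒∈H {w} ¬deep with w ∈? B
  ... | yes w∈B rewrite ∈B∧¬Deep⇒≡u w∈B ¬deep = x∈p∪q⁺ (inj₂ (x∈⁅x⁆ u))
  ... | no w∉B = x∈p∪q⁺ (inj₁ (x∉p⇒x∈∁p w∉B))

  data Shadow (r : Fin n) : Fin n → Set where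
    hidden  : Deep r → Shadow r u
    visible : ¬ Deep r → Shadow r r

  shadow : ∀ r → ∃ (Shadow r)
  shadow r with Deep? r
  ... | yes deep = u , hidden deep
  ... | no ¬deep = r , visible ¬deep

  Shadow⇒∈H : ∀ {r s} → Shadow r s → s ∈ H
  Shadow⇒∈H (hidden _) = x∈p∪q⁺ (inj₂ (x∈⁅x⁆ u))
  Shadow⇒∈H (visible ¬deep) = ¬Deep⇒∈H ¬deep

  occupied? : ∀ {k} (C : Fin k → Fin n) v → Dec (Occupied C v)
  occupied? C v = any? λ i → C i ≟ v

  deep-trapped : ∀ {k} {C : Fin k → Fin n} {r r′} → Occupied C u →
    RobberMove G ⊤ C r r′ → Deep r → Deep r′
  deep-trapped u-occ (here _) deep = deep
  deep-trapped u-occ (step run e (_ , free)) deep =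
    let (y∈B , y≢u) = deep-trapped u-occ run deep in
    closed y∈B y≢u e , λ { refl → free u-occ }

  capture : ∀ {k} (C : Fin k → Fin n) {i r} → C i ≡ u → Deep r → CopWin G ⊤ C r
  capture C {i} {r} Ci≡u (r∈B , r≢u) = move C′ cop-step (inj₁ (i , updateAt-updates i C))
    where
    C′ : Fin _ → Fin n
    C′ = updateAt C i (const r)

    cop-step : CopStep G ⊤ C C′
    cop-step j with j ≟ i
    ... | yes refl = ∈⊤ , inj₂ (subst₂ (E G) (sym Ci≡u) (sym (updateAt-updates i C))
                                  (dominating r r∈B r≢u))
    ... | no j≢i = ∈⊤ , inj₁ (updateAt-minimal j i C j≢i)

  shadow-move : ∀ {k} {C : Fin k → Fin n} {r r′ s} → ¬ Occupied C s → Shadow r s →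
    RobberMove G ⊤ C r r′ → ∃ λ s′ → Shadow r′ s′ × RobberMove G H C s s′
  shadow-move free sh (here _) = _ , sh , here (Shadow⇒∈H sh , free)
  shadow-move free sh (step {z = z} run e (_ , z-free)) with shadow-move free sh run | Deep? z
  ... | _ , hidden _ , moveH | yes z-deep = u , hidden z-deep , moveH
  ... | _ , hidden (y∈B , y≢u) , moveH | no ¬z-deep =
    u , subst (Shadow z) (∈B∧¬Deep⇒≡u (closed y∈B y≢u e) ¬z-deep) (visible ¬z-deep) , moveH
  ... | _ , visible ¬y-deep , moveH | yes z-deep@(z∈B , z≢u) =
    _ , subst (Shadow z) (sym (∈B∧¬Deep⇒≡u (closed z∈B z≢u (E-sym G e)) ¬y-deep)) (hidden z-deep)
      , moveH
  ... | _ , visible _ , moveH | no ¬z-deep =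
    z , visible ¬z-deep , step moveH e (¬Deep⇒∈H ¬z-deep , z-free)

  simulate : ∀ {k} {C : Fin k → Fin n} {r s} → CopWin G H C s → Shadow r s → CopWin G ⊤ C r
  simulate {s = s} (move C′ cop-step outcome) sh =
    move C′ (λ i → ∈⊤ , proj₂ (cop-step i)) (respond sh (occupied? C′ s) outcome)
    where
    respond : ∀ {r} → Shadow r s → Dec (Occupied C′ s) →
      Occupied C′ s ⊎ (∀ s′ → RobberMove G H C′ s s′ → CopWin G H C′ s′) →
      Occupied C′ r ⊎ (∀ r′ → RobberMove G ⊤ C′ r r′ → CopWin G ⊤ C′ r′)
    respond (visible _) (yes s-occ) _ = inj₁ s-occ
    respond (hidden deep) (yes (i , C′i≡u)) _ =
      inj₂ λ _ run → capture C′ C′i≡u (deep-trapped (i , C′i≡u) run deep)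
    respond _ (no free) (inj₁ s-occ) = ⊥-elim (free s-occ)
    respond sh (no free) (inj₂ continue) =
      inj₂ λ _ run → let (s′ , sh′ , moveH) = shadow-move free sh run in
        simulate (continue s′ moveH) sh′

  CopsWin-contraction⇒CopsWin : ∀ {k} → CopsWin G H k → CopsWin G ⊤ k
  CopsWin-contraction⇒CopsWin (C , C∈H , win) = C , (λ _ → ∈⊤) , λ r _ → first-round r
    where
    first-round : ∀ r → Occupied C r ⊎ CopWin G ⊤ C r
    first-round r with shadow r
    ... | s , sh with win s (Shadow⇒∈H sh) | sh
    ...   | inj₂ cop-win | _ = inj₂ (simulate cop-win sh)
    ...   | inj₁ s-occ | visible _ = inj₁ s-occ
    ...   | inj₁ (i , Ci≡u) | hidden deep = inj₂ (capture C Ci≡u deep)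

lemma2p6 : ∀ {n} (G : Graph n) (B : Subset n) (u : Fin n) →
    Connected G → BlockTreeNontrivial G → IsEndBlock G B →
    u ∈ B → IsCutVertex G u → (∀ w → w ∈ B → IsCutVertex G w → w ≡ u) →
    (∀ v → v ∈ B → v ≢ u → E G u v) →
    ∀ (cG cH : ℕ) → IsCopNumberInf G ⊤ cG → IsCopNumberInf G (ContractSet B u) cH →
    cG ≤ cH
lemma2p6 G B u _ _ (B-block , _) _ _ cut⇒≡u dominating cG cH (_ , cG-minimal) (H-win , _) =
  cG-minimal cH (CopsWin-contraction⇒CopsWin G B u closed dominating H-win)
  where
  closed : ∀ {b x} → b ∈ B → b ≢ u → E G b x → x ∈ B
  closed b∈B b≢u = noncut⇒neighbours-in-block G B-block b∈B (b≢u ∘ cut⇒≡u _ b∈B)
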